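{- Let $\phi$ be an LTL formula in the class on which $ofp$ is defined (see context). If there exists a position $i\ge0$ such that the propositional formula $ofp(\phi)\!\downarrow_i$ is unsatisfiable, then $\phi$ is unsatisfiable, i.e. no $\xi\in(2^{AP})^\omega$ satisfies $\xi\models\phi$.
   Context: Let $AP$ be a finite set of atomic propositions; a literal is $a$ or $\neg a$ with $a\in AP$. Consider LTL formulas generated by $\phi::=p\mid\phi\wedge\phi\mid\phi\vee\phi\mid X\phi\mid\phi U\phi\mid\phi R\phi\mid G\phi$, where $p$ is a literal. The left arguments of $U$ and $R$ may be arbitrary LTL formulas (including $\mathit{tt},\mathit{ff}$; e.g. $F\psi=\mathit{tt}U\psi$). Semantics over $\xi=\xi(0)\xi(1)\cdots\in(2^{AP})^\omega$ with suffixes $\xi_k$: - $\xi\models a$ iff $a\in\xi(0)$, and $\xi\models\neg a$ iff $a\notin\xi(0)$; - $\xi\models X\phi$ iff $\xi_1\models\phi$; - $\xi\models\phi_1U\phi_2$ iff $\exists i\ge0$ with $\xi_i\models\phi_2$ and $\xi_j\models\phi_1$ for all $j<i$; - $\xi\models\phi_1R\phi_2$ iff either $\xi_i\models\phi_2$ for all $i$, or $\exists i$ with $\xi_i\models\phi_1\wedge\phi_2$ and $\xi_j\models\phi_2$ for all $j<i$; - $\xi\models G\phi$ iff $\xi_i\models\phi$ for all $i$. A positional literal is a triple $l=\langle p,s,d\rangle$ with $l.prop=p$ a literal, $l.start=s\in\mathbb{N}\cup\{\star\}$ and $l.duration=d\in\{\mathrm{cur},\inf,\ge\}$. The formula $ofp(\phi)$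 is a positive Boolean combination of positional literals; $[ofp(\phi)]$ is the set of positional literals occurring in it. It is defined recursively: - $ofp(p)=\langle p,0,\mathrm{cur}\rangle$; - $ofp(\phi_1\wedge\phi_2)=ofp(\phi_1)\wedge ofp(\phi_2)$; - $ofp(\phi_1\vee\phi_2)=ofp(\phi_1)\vee ofp(\phi_2)$ if all positional literals in $[ofp(\phi_1)]\cup[ofp(\phi_2)]$ have the same start (where $\star$ equals $\star$). Otherwise $ofp(\phi_1\vee\phi_2)=ofp(\phi_1)'\vee ofp(\phi_2)'$, where $'$ replaces every $\langle p,s,d\rangle$ by $\langle p,\star,\mathrm{cur}\rangle$; - $ofp(X\psi)=Pos(ofp(\psi),X)$; - $ofp(\phi_1U\phi_2)=Pos(ofp(\phi_2),U)$; - $ofp(\phi_1R\phi_2)=Pos(ofp(\phi_2),R)$; - $ofp(G\psi)=Pos(ofp(\psi),G)$. $Pos(t,\mathit{type})$ replaces each positional literal of $t$, keeping the Boolean structure, according to the following rules, where $i\in\mathbb{N}$: - $\langle p,i,\mathrm{cur}\rangle$ becomes $\langle p,i+1,\mathrm{cur}\rangle$ under X, $\langle p,\star,\mathrm{cur}\rangle$ under U, $\langle p,i,\mathrm{cur}\rangle$ under R, and $\langle p,i,\ge\rangle$ under G; - $\langle p,\star,\mathrm{cur}\rangle$ stays $\langle p,\star,\mathrm{cur}\rangle$ under X, U and R, and becomes $\langle p,\star,\inf\rangle$ under G; - $\langle p,i,\ge\rangle$ becomes $\langle p,i+1,\ge\rangle$ under X, $\langle p,\star,\ge\rangle$ under U,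 and stays $\langle p,i,\ge\rangle$ under R and G; - $\langle p,\star,\ge\rangle$ is unchanged under X, U, R and G; - $\langle p,i,\inf\rangle$ becomes $\langle p,i+1,\inf\rangle$ under X, $\langle p,\star,\inf\rangle$ under U, and stays $\langle p,i,\inf\rangle$ under R and G; - $\langle p,\star,\inf\rangle$ is unchanged under X, U, R and G. Projection $ofp(\phi)\!\downarrow_i$, for $i\in\mathbb{N}$, is the propositional formula obtained from $ofp(\phi)$ by the following replacement: - each positional literal $l$ is replaced by $l.prop$ if $l.start=i$, or if $l.start\in\mathbb{N}$, $l.start<i$ and $l.duration=\ge$; - otherwise $l$ is replaced by $\mathit{tt}$; - $\wedge$ and $\vee$ are preserved. -}

module Defs where

open import Data.Nat using (ℕ; suc; _<_; _≟_)
open import Data.Bool using (Bool; true; false; _∧_; _∨_; not; if_then_else_)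
open import Data.List using (List; []; _∷_; _++_)
open import Data.Product using (Σ; ∃; _×_; _,_)
open import Relation.Nullary using (¬_; does)
open import Relation.Binary.PropositionalEquality using (_≡_)

module _ (AP : Set) where

  data Lit : Set where
    pos : AP → Lit
    neg : AP → Lit

  data LTL : Set where
    tt ff : LTL
    lit   : Lit → LTL
    ¬ₗ_   : LTL → LTL
    _∧ₗ_ _∨ₗ_ : LTL → LTL → LTL
    Xₗ Gₗ : LTL → LTL
    _Uₗ_ _Rₗ_ : LTL → LTL → LTL

  data Φ : Set where
    lit : Lit → Φ
    _∧ᶠ_ _∨ᶠ_ : Φ → Φ → Φ
    Xᶠ Gᶠ : Φ → Φ
    _Uᶠ_ _Rᶠ_ : LTL → Φ → Φ

  Word : Set
  Word = ℕ → AP → Bool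

  suffix : Word → ℕ → Word
  suffix ξ k i = ξ (k Data.Nat.+ i)

  _⊨lit_ : Word → Lit → Set
  ξ ⊨lit pos a = ξ 0 a ≡ true
  ξ ⊨lit neg a = ξ 0 a ≡ false

  _⊨_ : Word → LTL → Set
  ξ ⊨ tt = Data.Unit.⊤ where import Data.Unit
  ξ ⊨ ff = Data.Empty.⊥ where import Data.Empty
  ξ ⊨ lit p = ξ ⊨lit p
  ξ ⊨ (¬ₗ φ) = ¬ (ξ ⊨ φ)
  ξ ⊨ (φ ∧ₗ ψ) = (ξ ⊨ φ) × (ξ ⊨ ψ)
  ξ ⊨ (φ ∨ₗ ψ) = (ξ ⊨ φ) Data.Sum.⊎ (ξ ⊨ ψ) where import Data.Sum
  ξ ⊨ Xₗ φ = suffix ξ 1 ⊨ φ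
  ξ ⊨ Gₗ φ = ∀ i → suffix ξ i ⊨ φ
  ξ ⊨ (φ Uₗ ψ) = ∃ λ i → (suffix ξ i ⊨ ψ) × (∀ j → j < i → suffix ξ j ⊨ φ)
  ξ ⊨ (φ Rₗ ψ) = (∀ i → suffix ξ i ⊨ ψ) Data.Sum.⊎
                 (∃ λ i → (suffix ξ i ⊨ φ) × (suffix ξ i ⊨ ψ) × (∀ j → j < i → suffix ξ j ⊨ ψ))
    where import Data.Sum

  _⊨ᶠ_ : Word → Φ → Set
  ξ ⊨ᶠ lit p = ξ ⊨lit p
  ξ ⊨ᶠ (φ ∧ᶠ ψ) = (ξ ⊨ᶠ φ) × (ξ ⊨ᶠ ψ)
  ξ ⊨ᶠ (φ ∨ᶠ ψ) = (ξ ⊨ᶠ φ) Data.Sum.⊎ (ξ ⊨ᶠ ψ) where import Data.Sum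
  ξ ⊨ᶠ Xᶠ φ = suffix ξ 1 ⊨ᶠ φ
  ξ ⊨ᶠ Gᶠ φ = ∀ i → suffix ξ i ⊨ᶠ φ
  ξ ⊨ᶠ (φ Uᶠ ψ) = ∃ λ i → (suffix ξ i ⊨ᶠ ψ) × (∀ j → j < i → suffix ξ j ⊨ φ)
  ξ ⊨ᶠ (φ Rᶠ ψ) = (∀ i → suffix ξ i ⊨ᶠ ψ) Data.Sum.⊎
                  (∃ λ i → (suffix ξ i ⊨ φ) × (suffix ξ i ⊨ᶠ ψ) × (∀ j → j < i → suffix ξ j ⊨ᶠ ψ))
    where import Data.Sum

  data Start : Set where
    at   : ℕ → Start
    star : Start

  data Duration : Set where
    cur inf ge : Duration

  record PosLit : Set where
    constructor ⟨_,_,_⟩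
    field
      prop     : Lit
      start    : Start
      duration : Duration

  data PF : Set where
    leaf : PosLit → PF
    _∧ᵖ_ _∨ᵖ_ : PF → PF → PF

  mapPF : (PosLit → PosLit) → PF → PF
  mapPF f (leaf l) = leaf (f l)
  mapPF f (s ∧ᵖ t) = mapPF f s ∧ᵖ mapPF f t
  mapPF f (s ∨ᵖ t) = mapPF f s ∨ᵖ mapPF f t

  starts : PF → List Start
  starts (leaf ⟨ _ , s , _ ⟩) = s ∷ []
  starts (s ∧ᵖ t) = starts s ++ starts t
  starts (s ∨ᵖ t) = starts s ++ starts t

  start≡ᵇ : Start → Start → Bool
  start≡ᵇ (at i) (at j) = does (i ≟ j)
  start≡ᵇ star star = true
  start≡ᵇ _ _ = false

  allL : (Start → Bool) → List Start → Bool
  allL f [] = true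
  allL f (x ∷ xs) = f x ∧ allL f xs

  sameStart : List Start → Bool
  sameStart [] = true
  sameStart (s ∷ ss) = allL (start≡ᵇ s) ss

  starify : PosLit → PosLit
  starify ⟨ p , _ , _ ⟩ = ⟨ p , star , cur ⟩

  data Type : Set where
    TX TU TR TG : Type

  posLit : Type → PosLit → PosLit
  posLit TX ⟨ p , at i , cur ⟩ = ⟨ p , at (suc i) , cur ⟩
  posLit TU ⟨ p , at i , cur ⟩ = ⟨ p , star , cur ⟩
  posLit TR ⟨ p , at i , cur ⟩ = ⟨ p , at i , cur ⟩
  posLit TG ⟨ p , at i , cur ⟩ = ⟨ p , at i , ge ⟩
  posLit TG ⟨ p , star , cur ⟩ = ⟨ p , star , inf ⟩
  posLit _  ⟨ p , star , cur ⟩ = ⟨ p , star , cur ⟩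
  posLit TX ⟨ p , at i , ge ⟩ = ⟨ p , at (suc i) , ge ⟩
  posLit TU ⟨ p , at i , ge ⟩ = ⟨ p , star , ge ⟩
  posLit _  ⟨ p , at i , ge ⟩ = ⟨ p , at i , ge ⟩
  posLit _  ⟨ p , star , ge ⟩ = ⟨ p , star , ge ⟩
  posLit TX ⟨ p , at i , inf ⟩ = ⟨ p , at (suc i) , inf ⟩
  posLit TU ⟨ p , at i , inf ⟩ = ⟨ p , star , inf ⟩
  posLit _  ⟨ p , at i , inf ⟩ = ⟨ p , at i , inf ⟩
  posLit _  ⟨ p , star , inf ⟩ = ⟨ p , star , inf ⟩

  Pos : PF → Type → PF
  Pos t ty = mapPF (posLit ty) t

  ofp : Φ → PF
  ofp (lit p) = leaf ⟨ p , at 0 , cur ⟩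
  ofp (φ₁ ∧ᶠ φ₂) = ofp φ₁ ∧ᵖ ofp φ₂
  ofp (φ₁ ∨ᶠ φ₂) =
    if sameStart (starts (ofp φ₁) ++ starts (ofp φ₂))
    then ofp φ₁ ∨ᵖ ofp φ₂
    else mapPF starify (ofp φ₁) ∨ᵖ mapPF starify (ofp φ₂)
  ofp (Xᶠ ψ) = Pos (ofp ψ) TX
  ofp (φ₁ Uᶠ φ₂) = Pos (ofp φ₂) TU
  ofp (φ₁ Rᶠ φ₂) = Pos (ofp φ₂) TR
  ofp (Gᶠ ψ) = Pos (ofp ψ) TG

  data Prop : Set where
    ttᵖ : Prop
    litᵖ : Lit → Prop
    _∧ᵠ_ _∨ᵠ_ : Prop → Prop → Prop

  evalLit : (AP → Bool) → Lit → Bool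
  evalLit σ (pos a) = σ a
  evalLit σ (neg a) = not (σ a)

  eval : (AP → Bool) → Prop → Bool
  eval σ ttᵖ = true
  eval σ (litᵖ p) = evalLit σ p
  eval σ (s ∧ᵠ t) = eval σ s ∧ eval σ t
  eval σ (s ∨ᵠ t) = eval σ s ∨ eval σ t

  Satisfiable : Prop → Set
  Satisfiable f = ∃ λ (σ : AP → Bool) → eval σ f ≡ true

  keep : ℕ → PosLit → Bool
  keep i ⟨ _ , at s , ge ⟩ = does (s ≟ i) ∨ does (s Data.Nat.<? i)
  keep i ⟨ _ , at s , _ ⟩ = does (s ≟ i)
  keep i ⟨ _ , star , _ ⟩ = false

  proj : PF → ℕ → Prop
  proj (leaf l) i = if keep i l then litᵖ (PosLit.prop l) else ttᵖ
  proj (s ∧ᵖ t) i = proj s i ∧ᵠ proj t i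
  proj (s ∨ᵖ t) i = proj s i ∨ᵠ proj t i

-- A model ξ of φ satisfies the projection ofp(φ)↓ᵢ under the valuation ξ(i), for every i,
-- so an unsatisfiable projection leaves φ without models. Each operator either keeps a
-- positional literal only where its proposition is forced to hold (literals, X, R), or
-- moves it to start ⋆ where the projection drops it (U, the mixed-start disjunction).
-- The one delicate case is G: there ofp(ψ) is a conjunction of blocks whose literals all
-- share one start m (this is exactly what the rule for ∨ enforces), so at position i a
-- block is either dropped entirely (i < m) or is read off ψ's block at m on the suffix
-- ξ_{i−m}, with some of its literals weakened to tt.

module Submission where

open import Defs
open import Data.Nat using (ℕ; suc; _+_; _∸_; _≤_; _≤?_; s≤s; z≤n)
open import Data.Nat.Properties
  using (≡ᵇ⇒≡; ≡⇒≡ᵇ; ≤ᵇ⇒≤; ≤-reflexive; <⇒≤; m∸n+n≡m)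
open import Data.Empty using (⊥-elim)
open import Data.Fin using (Fin)
open import Data.Bool using (Bool; true; false; T)
open import Data.Bool.Properties using (T-≡; T-not-≡; T-∧; T-∨)
open import Data.List using ([]; _∷_)
open import Data.List.Relation.Unary.All as All using (All; []; _∷_)
open import Data.List.Relation.Unary.All.Properties using (++⁻)
open import Data.Product using (∃; _,_; proj₁; proj₂)
open import Data.Sum as Sum using (inj₁; inj₂; [_,_]′)
open import Function using (_∘_; _⇔_; mk⇔; Equivalence)
open import Relation.Nullary using (¬_; yes; no)
open import Relation.Binary.PropositionalEquality using (_≡_; refl; sym; trans; cong; subst)

open Equivalence using (to; from)

module _ {A : Set} where

  open PosLit

  Holds : (A → Bool) → PF A → ℕ → Set
  Holds σ t i = T (eval A σ (proj A t i))

  data AllLeaves (P : PosLit A → Set) : PF A → Set where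
    leaf : ∀ {l} → P l → AllLeaves P (leaf l)
    _∧ᵖ_ : ∀ {s t} → AllLeaves P s → AllLeaves P t → AllLeaves P (s ∧ᵖ t)
    _∨ᵖ_ : ∀ {s t} → AllLeaves P s → AllLeaves P t → AllLeaves P (s ∨ᵖ t)

  AllLeaves-universal : ∀ {P} → (∀ l → P l) → ∀ t → AllLeaves P t
  AllLeaves-universal p (leaf l) = leaf (p l)
  AllLeaves-universal p (s ∧ᵖ t) = AllLeaves-universal p s ∧ᵖ AllLeaves-universal p t
  AllLeaves-universal p (s ∨ᵖ t) = AllLeaves-universal p s ∨ᵖ AllLeaves-universal p t

  AllLeaves-map : ∀ {P Q} → (∀ {l} → P l → Q l) → ∀ {t} → AllLeaves P t → AllLeaves Q t
  AllLeaves-map g (leaf p) = leaf (g p)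
  AllLeaves-map g (p ∧ᵖ q) = AllLeaves-map g p ∧ᵖ AllLeaves-map g q
  AllLeaves-map g (p ∨ᵖ q) = AllLeaves-map g p ∨ᵖ AllLeaves-map g q

  AllLeaves-mapPF⁺ : ∀ {P} f {t} → AllLeaves (P ∘ f) t → AllLeaves P (mapPF A f t)
  AllLeaves-mapPF⁺ f (leaf p) = leaf p
  AllLeaves-mapPF⁺ f (p ∧ᵖ q) = AllLeaves-mapPF⁺ f p ∧ᵖ AllLeaves-mapPF⁺ f q
  AllLeaves-mapPF⁺ f (p ∨ᵖ q) = AllLeaves-mapPF⁺ f p ∨ᵖ AllLeaves-mapPF⁺ f q

  AllLeaves-starts : ∀ {P} t → All P (starts A t) → AllLeaves (P ∘ start) t
  AllLeaves-starts (leaf l) (p ∷ []) = leaf p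
  AllLeaves-starts (s ∧ᵖ t) h =
    let ps , pt = ++⁻ (starts A s) h in AllLeaves-starts s ps ∧ᵖ AllLeaves-starts t pt
  AllLeaves-starts (s ∨ᵖ t) h =
    let ps , pt = ++⁻ (starts A s) h in AllLeaves-starts s ps ∨ᵖ AllLeaves-starts t pt

  holds-leaf : ∀ σ i l → Holds σ (leaf l) i ⇔ (T (keep A i l) → T (evalLit A σ (prop l)))
  holds-leaf σ i l with keep A i l
  ... | true  = mk⇔ (λ h _ → h) (λ h → h _)
  ... | false = mk⇔ (λ _ ()) (λ _ → _)

  holds-if-dropped : ∀ {σ i t} → AllLeaves (λ l → ¬ T (keep A i l)) t → Holds σ t i
  holds-if-dropped {σ} {i} (leaf {l} d) = from (holds-leaf σ i l) (⊥-elim ∘ d)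
  holds-if-dropped (d ∧ᵖ e) = from T-∧ (holds-if-dropped d , holds-if-dropped e)
  holds-if-dropped (d ∨ᵖ _) = from T-∨ (inj₁ (holds-if-dropped d))

  holds-if-all-dropped : ∀ {σ i} f → (∀ l → ¬ T (keep A i (f l))) →
                         ∀ t → Holds σ (mapPF A f t) i
  holds-if-all-dropped f d t =
    holds-if-dropped (AllLeaves-mapPF⁺ f (AllLeaves-universal d t))

  -- Projections are positive, so keeping fewer literals can only preserve truth.
  holds-transfer : ∀ {σ i j} f → (∀ l → prop (f l) ≡ prop l) → ∀ t →
    AllLeaves (λ l → T (keep A i (f l)) → T (keep A j l)) t →
    Holds σ t j → Holds σ (mapPF A f t) i
  holds-transfer {σ} {i} {j} f f-prop (leaf l) (leaf c) h =
    from (holds-leaf σ i (f l)) λ k →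
      subst (T ∘ evalLit A σ) (sym (f-prop l)) (to (holds-leaf σ j l) h (c k))
  holds-transfer f f-prop (s ∧ᵖ t) (c ∧ᵖ d) h =
    let hs , ht = to T-∧ h in
    from T-∧ (holds-transfer f f-prop s c hs , holds-transfer f f-prop t d ht)
  holds-transfer f f-prop (s ∨ᵖ t) (c ∨ᵖ d) h =
    from T-∨ (Sum.map (holds-transfer f f-prop s c) (holds-transfer f f-prop t d) (to T-∨ h))

  shift : Type A → Start A → Start A
  shift TX (at i) = at (suc i)
  shift TX star   = star
  shift TU _      = star
  shift TR s      = s
  shift TG s      = s

  stretch : Type A → Start A → Duration A → Duration A
  stretch TG (at _) cur = ge
  stretch TG star   cur = inf
  stretch _  _      d   = d

  posLit-componentwise : ∀ {p} ty s d →
                         posLit A ty ⟨ p , s , d ⟩ ≡ ⟨ p , shift ty s , stretch ty s d ⟩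
  posLit-componentwise TX (at _) = λ { cur → refl ; ge → refl ; inf → refl }
  posLit-componentwise TX star   = λ { cur → refl ; ge → refl ; inf → refl }
  posLit-componentwise TU (at _) = λ { cur → refl ; ge → refl ; inf → refl }
  posLit-componentwise TU star   = λ { cur → refl ; ge → refl ; inf → refl }
  posLit-componentwise TR (at _) = λ { cur → refl ; ge → refl ; inf → refl }
  posLit-componentwise TR star   = λ { cur → refl ; ge → refl ; inf → refl }
  posLit-componentwise TG (at _) = λ { cur → refl ; ge → refl ; inf → refl }
  posLit-componentwise TG star   = λ { cur → refl ; ge → refl ; inf → refl }

  prop-posLit : ∀ ty l → prop (posLit A ty l) ≡ prop l
  prop-posLit ty l = cong prop (posLit-componentwise ty (start l) (duration l))

  start-posLit : ∀ ty l → start (posLit A ty l) ≡ shift ty (start l)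
  start-posLit ty l = cong start (posLit-componentwise ty (start l) (duration l))

  posLit-TR : ∀ l → posLit A TR l ≡ l
  posLit-TR l = posLit-componentwise TR (start l) (duration l)

  G-start : ∀ {s} l → start l ≡ s → start (posLit A TG l) ≡ s
  G-start l = trans (start-posLit TG l)

  keep-star : ∀ {i} l → start l ≡ star → ¬ T (keep A i l)
  keep-star ⟨ _ , star , _ ⟩ refl ()

  keep⇒started : ∀ {i m} l → T (keep A i l) → start l ≡ at m → m ≤ i
  keep⇒started {i} ⟨ _ , at m , cur ⟩ k refl = ≤-reflexive (≡ᵇ⇒≡ m i k)
  keep⇒started {i} ⟨ _ , at m , inf ⟩ k refl = ≤-reflexive (≡ᵇ⇒≡ m i k)
  keep⇒started {i} ⟨ _ , at m , ge  ⟩ k refl =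
    [ ≤-reflexive ∘ ≡ᵇ⇒≡ m i , <⇒≤ ∘ ≤ᵇ⇒≤ (suc m) i ]′ (to T-∨ k)

  keep-at-start : ∀ {m} l → start l ≡ at m → T (keep A m l)
  keep-at-start ⟨ _ , at m , cur ⟩ refl = ≡⇒≡ᵇ m m refl
  keep-at-start ⟨ _ , at m , inf ⟩ refl = ≡⇒≡ᵇ m m refl
  keep-at-start ⟨ _ , at m , ge  ⟩ refl = from T-∨ (inj₁ (≡⇒≡ᵇ m m refl))

  keep-X-suc : ∀ j l → keep A (suc j) (posLit A TX l) ≡ keep A j l
  keep-X-suc j ⟨ _ , at _ , cur ⟩ = refl
  keep-X-suc j ⟨ _ , at _ , ge  ⟩ = refl
  keep-X-suc j ⟨ _ , at _ , inf ⟩ = refl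
  keep-X-suc j ⟨ _ , star , cur ⟩ = refl
  keep-X-suc j ⟨ _ , star , ge  ⟩ = refl
  keep-X-suc j ⟨ _ , star , inf ⟩ = refl

  keep-X-zero : ∀ l → ¬ T (keep A 0 (posLit A TX l))
  keep-X-zero ⟨ _ , at _ , cur ⟩ ()
  keep-X-zero ⟨ _ , at _ , ge  ⟩ ()
  keep-X-zero ⟨ _ , at _ , inf ⟩ ()
  keep-X-zero ⟨ _ , star , cur ⟩ ()
  keep-X-zero ⟨ _ , star , ge  ⟩ ()
  keep-X-zero ⟨ _ , star , inf ⟩ ()

  UniformStart : Start A → PF A → Set
  UniformStart s = AllLeaves (λ l → start l ≡ s)

  data ConjUniform : PF A → Set where
    uniform : ∀ {s t} → UniformStart s t → ConjUniform t
    _∧ᵘ_    : ∀ {s t} → ConjUniform s → ConjUniform t → ConjUniform (s ∧ᵖ t)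

  start≡ᵇ-sound : ∀ s s′ → T (start≡ᵇ A s s′) → s′ ≡ s
  start≡ᵇ-sound (at i) (at j) h = cong at (sym (≡ᵇ⇒≡ i j h))
  start≡ᵇ-sound star   star   _ = refl

  allL-sound : ∀ (f : Start A → Bool) xs → T (allL A f xs) → All (T ∘ f) xs
  allL-sound f []       _ = []
  allL-sound f (x ∷ xs) h = let hx , hxs = to T-∧ h in hx ∷ allL-sound f xs hxs

  sameStart-sound : ∀ xs → T (sameStart A xs) → ∃ λ s → All (_≡ s) xs
  sameStart-sound []       _ = star , []
  sameStart-sound (s ∷ ss) h =
    s , refl ∷ All.map (start≡ᵇ-sound s _) (allL-sound (start≡ᵇ A s) ss h)

  ConjUniform-Pos : ∀ ty {t} → ConjUniform t → ConjUniform (Pos A t ty)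
  ConjUniform-Pos ty (uniform u) =
    uniform (AllLeaves-mapPF⁺ (posLit A ty)
      (AllLeaves-map (λ {l} eq → trans (start-posLit ty l) (cong (shift ty) eq)) u))
  ConjUniform-Pos ty (c ∧ᵘ d) = ConjUniform-Pos ty c ∧ᵘ ConjUniform-Pos ty d

  starify-uniform : ∀ t → UniformStart star (mapPF A (starify A) t)
  starify-uniform t = AllLeaves-mapPF⁺ (starify A) (AllLeaves-universal (λ _ → refl) t)

  ofp-conjUniform : ∀ φ → ConjUniform (ofp A φ)
  ofp-conjUniform (lit p)   = uniform (leaf refl)
  ofp-conjUniform (φ ∧ᶠ ψ)  = ofp-conjUniform φ ∧ᵘ ofp-conjUniform ψ
  ofp-conjUniform (φ ∨ᶠ ψ) with sameStart A (starts A (ofp A φ ∨ᵖ ofp A ψ)) in same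
  ... | true  = let _ , all≡ = sameStart-sound _ (from T-≡ same) in
                uniform (AllLeaves-starts (ofp A φ ∨ᵖ ofp A ψ) all≡)
  ... | false = uniform (starify-uniform (ofp A φ) ∨ᵖ starify-uniform (ofp A ψ))
  ofp-conjUniform (Xᶠ φ)    = ConjUniform-Pos TX (ofp-conjUniform φ)
  ofp-conjUniform (Gᶠ φ)    = ConjUniform-Pos TG (ofp-conjUniform φ)
  ofp-conjUniform (_ Uᶠ φ)  = ConjUniform-Pos TU (ofp-conjUniform φ)
  ofp-conjUniform (_ Rᶠ φ)  = ConjUniform-Pos TR (ofp-conjUniform φ)

  holds-G-uniform : ∀ (ξ : Word A) {s t} → UniformStart s t →
    (∀ j k → Holds (ξ (k + j)) t j) → ∀ i → Holds (ξ i) (Pos A t TG) i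
  holds-G-uniform ξ {star} u _ i =
    holds-if-dropped (AllLeaves-mapPF⁺ (posLit A TG)
      (AllLeaves-map (λ {l} eq → keep-star (posLit A TG l) (G-start l eq)) u))
  holds-G-uniform ξ {at m} {t} u h i with m ≤? i
  ... | no m≰i =
    holds-if-dropped (AllLeaves-mapPF⁺ (posLit A TG)
      (AllLeaves-map (λ {l} eq k → m≰i (keep⇒started (posLit A TG l) k (G-start l eq))) u))
  ... | yes m≤i =
    holds-transfer (posLit A TG) (prop-posLit TG) t
      (AllLeaves-map (λ {l} eq _ → keep-at-start l eq) u)
      (subst (λ n → Holds (ξ n) t m) (m∸n+n≡m m≤i) (h m (i ∸ m)))

  holds-G : ∀ (ξ : Word A) {t} → ConjUniform t →
    (∀ j k → Holds (ξ (k + j)) t j) → ∀ i → Holds (ξ i) (Pos A t TG) i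
  holds-G ξ (uniform u) h i = holds-G-uniform ξ u h i
  holds-G ξ (c ∧ᵘ d)   h i = from T-∧
    ( holds-G ξ c (λ j k → proj₁ (to T-∧ (h j k))) i
    , holds-G ξ d (λ j k → proj₂ (to T-∧ (h j k))) i )

  ⊨lit⇒evalLit : ∀ (ξ : Word A) p → _⊨lit_ A ξ p → T (evalLit A (ξ 0) p)
  ⊨lit⇒evalLit ξ (pos a) h = from T-≡ h
  ⊨lit⇒evalLit ξ (neg a) h = from T-not-≡ h

  release⇒now : ∀ (ξ : Word A) ψ φ → _⊨ᶠ_ A ξ (ψ Rᶠ φ) → _⊨ᶠ_ A ξ φ
  release⇒now ξ ψ φ (inj₁ always)                  = always 0
  release⇒now ξ ψ φ (inj₂ (0     , _ , now , _))    = now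
  release⇒now ξ ψ φ (inj₂ (suc _ , _ , _ , before)) = before 0 (s≤s z≤n)

  ofp-sound : ∀ φ (ξ : Word A) → _⊨ᶠ_ A ξ φ → ∀ i → Holds (ξ i) (ofp A φ) i
  ofp-sound (lit p) ξ h 0       = ⊨lit⇒evalLit ξ p h
  ofp-sound (lit p) ξ h (suc _) = _
  ofp-sound (φ ∧ᶠ ψ) ξ (hφ , hψ) i =
    from T-∧ (ofp-sound φ ξ hφ i , ofp-sound ψ ξ hψ i)
  ofp-sound (φ ∨ᶠ ψ) ξ h i with sameStart A (starts A (ofp A φ ∨ᵖ ofp A ψ))
  ... | true  = from T-∨ (Sum.map (λ hφ → ofp-sound φ ξ hφ i) (λ hψ → ofp-sound ψ ξ hψ i) h)
  ... | false = from T-∨ (inj₁ (holds-if-all-dropped (starify A) (λ _ ()) (ofp A φ)))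
  ofp-sound (Xᶠ φ) ξ _ 0 = holds-if-all-dropped (posLit A TX) keep-X-zero (ofp A φ)
  ofp-sound (Xᶠ φ) ξ h (suc j) =
    holds-transfer (posLit A TX) (prop-posLit TX) (ofp A φ)
      (AllLeaves-universal (λ l → subst T (keep-X-suc j l)) (ofp A φ))
      (ofp-sound φ (suffix A ξ 1) h j)
  ofp-sound (Gᶠ φ) ξ h i =
    holds-G ξ (ofp-conjUniform φ) (λ j k → ofp-sound φ (suffix A ξ k) (h k) j) i
  ofp-sound (_ Uᶠ φ) ξ _ i =
    holds-if-all-dropped (posLit A TU)
      (λ l → keep-star (posLit A TU l) (start-posLit TU l)) (ofp A φ)
  ofp-sound (ψ Rᶠ φ) ξ h i =
    holds-transfer (posLit A TR) (prop-posLit TR) (ofp A φ)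
      (AllLeaves-universal (λ l → subst (T ∘ keep A i) (posLit-TR l)) (ofp A φ))
      (ofp-sound φ ξ (release⇒now ξ ψ φ h) i)

theorem5 : (n : ℕ) (φ : Φ (Fin n)) →
    (∃ λ (i : ℕ) → ¬ Satisfiable (Fin n) (proj (Fin n) (ofp (Fin n) φ) i)) →
    ¬ (∃ λ (ξ : Word (Fin n)) → _⊨ᶠ_ (Fin n) ξ φ)
theorem5 n φ (i , unsat) (ξ , ξ⊨φ) = unsat (ξ i , to T-≡ (ofp-sound φ ξ ξ⊨φ i))
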